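{- Let $q$ be a prime power and $v,k$ integers with $k\ge 2$. A $2$-$(v,k,1)_q$ design exists only if $v\equiv 1$ or $v\equiv k \pmod{k(k-1)}$.
   Context: A $2$-$(v,k,1)_q$ design (Steiner $2$-design over $\mathbb{F}_q$) is a collection $\mathcal{S}$ of $k$-dimensional subspaces of the vector space $\mathbb{F}_q^v$ such that every $2$-dimensional subspace of $\mathbb{F}_q^v$ is contained in exactly one member of $\mathcal{S}$. -}

module Defs where

open import Data.Nat using (ℕ; zero; suc; _^_; _≤_)
open import Data.Nat.Primality using (Prime)
open import Data.Fin using (Fin)
import Data.Fin as Fin
open import Data.Vec using (Vec; replicate; zipWith; map)
open import Data.Product using (Σ; ∃; _×_; ∃-syntax)
open import Relation.Binary.PropositionalEquality using (_≡_; _≢_)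
open import Algebra.Structures using (IsCommutativeRing)
open import Function.Bundles using (_↔_)

IsPrimePower : ℕ → Set
IsPrimePower q = ∃[ p ] ∃[ e ] (Prime p × 1 ≤ e × q ≡ p ^ e)

record FiniteField (q : ℕ) : Set₁ where
  field
    Carrier : Set
    _+_ _*_ : Carrier → Carrier → Carrier
    -_      : Carrier → Carrier
    0# 1#   : Carrier
    isCommutativeRing : IsCommutativeRing _≡_ _+_ _*_ -_ 0# 1#
    0≢1     : 0# ≢ 1#
    inverse : ∀ x → x ≢ 0# → ∃[ y ] (x * y ≡ 1#)
    enum    : Carrier ↔ Fin q

module VectorSpace {q : ℕ} (F : FiniteField q) (v : ℕ) where
  open FiniteField F

  Vector : Set
  Vector = Vec Carrier v

  zeroV : Vector
  zeroV = replicate v 0#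

  _+V_ : Vector → Vector → Vector
  _+V_ = zipWith _+_

  _·V_ : Carrier → Vector → Vector
  a ·V x = map (a *_) x

  lincomb : ∀ {n} → (Fin n → Carrier) → (Fin n → Vector) → Vector
  lincomb {zero}  c b = zeroV
  lincomb {suc n} c b = (c Fin.zero ·V b Fin.zero) +V lincomb (λ i → c (Fin.suc i)) (λ i → b (Fin.suc i))

  LinearlyIndependent : ∀ {n} → (Fin n → Vector) → Set
  LinearlyIndependent {n} b = ∀ (c : Fin n → Carrier) → lincomb c b ≡ zeroV → ∀ i → c i ≡ 0#

  -- An n-dimensional subspace of F_q^v, presented by a basis (n linearly independent vectors);
  -- the subspace itself is the span of the basis.
  record Subspace (n : ℕ) : Set where
    field
      basis       : Fin n → Vector
      independent : LinearlyIndependent basis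

  _∈_ : ∀ {n} → Vector → Subspace n → Set
  _∈_ {n} x U = ∃[ c ] (x ≡ lincomb c (Subspace.basis U))

  _⊆_ : ∀ {m n} → Subspace m → Subspace n → Set
  T ⊆ U = ∀ x → x ∈ T → x ∈ U

record SteinerDesign {q : ℕ} (F : FiniteField q) (v k : ℕ) : Set₁ where
  open VectorSpace F v
  field
    Index  : Set
    block  : Index → Subspace k
    steiner : ∀ (T : Subspace 2) → ∃[ i ] (T ⊆ block i × (∀ j → T ⊆ block j → j ≡ i))

module Submission where

-- An ordered pair of independent vectors of F_q^v spans a 2-space, which lies in exactly one block.
-- Grouping the (q^v − 1)(q^v − q) independent pairs by that block, each class consists of the
-- independent pairs of a block, which correspond via coordinates to those of F_q^k, so it has
-- (q^k − 1)(q^k − q) elements; likewise, for a fixed nonzero x the q^v − q vectors independent of x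
-- fall into classes of size q^k − q. With M a = q^a − 1 this gives M(k − 1) ∣ M(v − 1) and
-- M k ∣ M v · M(v − 1). As gcd (M a) (M b) = M (gcd a b), the first means k − 1 ∣ v − 1, and the
-- second forces k ∣ v or k ∣ v − 1: otherwise a = gcd(k, v) and b = gcd(k, v − 1) would be coprime
-- proper divisors of k, so a + b ≤ k and M a · M b < M k, although M k ∣ M a · M b. Since k and
-- k − 1 are coprime, k(k − 1) then divides v − 1 or v − k.

open import Defs
open import Data.Nat using (ℕ)

module Counting where

  open import Data.Bool using (Bool; true; false; not; _∧_)
  open import Data.Fin as Fin using (Fin)
  open import Data.List using (List; []; _∷_; _++_; map; length; filter; cartesianProduct; allFin)
  open import Data.List.Membership.Propositional using (_∈_; lose)
  open import Data.List.Membership.Propositional.Properties using (∈-filter⁻)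
  open import Data.List.Properties using (length-filter; length-map; length-tabulate; map-tabulate)
  open import Data.List.Relation.Unary.All using (All; []; _∷_)
  open import Data.List.Relation.Unary.All.Properties using (all-filter; filter⁺)
  open import Data.List.Relation.Unary.Any as Any using (Any; here; there)
  open import Data.Nat using (ℕ; zero; suc; _+_; _*_; _∸_; _^_; _≤_; s≤s)
  open import Data.Nat.Divisibility using (_∣_; _∣0; ∣-refl; ∣m∣n⇒∣m+n)
  open import Data.Nat.Properties
    using (+-assoc; +-comm; +-identityʳ; *-comm; *-zeroʳ; *-identityʳ; *-distribˡ-+; m+n∸n≡m; 1+n≢0; ≤-refl; ≤-trans;
           +-commutativeSemigroup)
  open import Algebra.Properties.CommutativeSemigroup +-commutativeSemigroup using (interchange)
  open import Data.Product using (_×_; _,_; ∃; proj₁; proj₂; uncurry)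
  open import Data.Product.Properties using (,-injective)
  open import Data.Vec as Vec using (Vec; []; _∷_)
  open import Function using (_∘_; _⇔_; Equivalence; mk⇔)
  open import Function.Bundles using (_↔_; Inverse; mk↔ₛ′)
  open import Function.Definitions using (Injective)
  open import Level using (0ℓ)
  open import Relation.Binary.Definitions using (DecidableEquality)
  open import Relation.Binary.PropositionalEquality
  open import Relation.Nullary using (Dec; does; yes; no; ¬_; contradiction)
  open import Relation.Nullary.Decidable using (map′; _×-dec_; does-⇔; dec-true; dec-false)
  open import Relation.Unary using (Pred; Decidable)
  open import Relation.Unary.Properties using (∁?; _∩?_)

  private variable A B : Set

  ∑ : (A → ℕ) → List A → ℕ
  ∑ f []       = 0
  ∑ f (x ∷ xs) = f x + ∑ f xs

  ∑-cong : ∀ {f g : A → ℕ} → (∀ x → f x ≡ g x) → ∀ xs → ∑ f xs ≡ ∑ g xs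
  ∑-cong f≗g []       = refl
  ∑-cong f≗g (x ∷ xs) = cong₂ _+_ (f≗g x) (∑-cong f≗g xs)

  ∑-+ : ∀ (f g : A → ℕ) xs → ∑ (λ x → f x + g x) xs ≡ ∑ f xs + ∑ g xs
  ∑-+ f g []       = refl
  ∑-+ f g (x ∷ xs) = trans (cong (f x + g x +_) (∑-+ f g xs)) (interchange (f x) (g x) _ _)

  ∑-*ˡ : ∀ c (f : A → ℕ) xs → ∑ (λ x → c * f x) xs ≡ c * ∑ f xs
  ∑-*ˡ c f []       = sym (*-zeroʳ c)
  ∑-*ˡ c f (x ∷ xs) = trans (cong (c * f x +_) (∑-*ˡ c f xs)) (sym (*-distribˡ-+ c (f x) _))

  ∑-zero : ∀ (xs : List A) → ∑ (λ _ → 0) xs ≡ 0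
  ∑-zero []       = refl
  ∑-zero (x ∷ xs) = ∑-zero xs

  ∑-one : ∀ (xs : List A) → ∑ (λ _ → 1) xs ≡ length xs
  ∑-one []       = refl
  ∑-one (x ∷ xs) = cong suc (∑-one xs)

  ∑-map : ∀ (f : B → ℕ) (g : A → B) xs → ∑ f (map g xs) ≡ ∑ (f ∘ g) xs
  ∑-map f g []       = refl
  ∑-map f g (x ∷ xs) = cong (f (g x) +_) (∑-map f g xs)

  ∑-++ : ∀ (f : A → ℕ) xs ys → ∑ f (xs ++ ys) ≡ ∑ f xs + ∑ f ys
  ∑-++ f []       ys = refl
  ∑-++ f (x ∷ xs) ys = trans (cong (f x +_) (∑-++ f xs ys)) (sym (+-assoc (f x) _ _))

  ∑-cartesianProduct : ∀ (f : A × B → ℕ) xs ys →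
    ∑ f (cartesianProduct xs ys) ≡ ∑ (λ x → ∑ (λ y → f (x , y)) ys) xs
  ∑-cartesianProduct f []       ys = refl
  ∑-cartesianProduct f (x ∷ xs) ys =
    trans (∑-++ f (map (x ,_) ys) _) (cong₂ _+_ (∑-map f (x ,_) ys) (∑-cartesianProduct f xs ys))

  ∑-swap : ∀ (f : A → B → ℕ) xs ys → ∑ (λ x → ∑ (f x) ys) xs ≡ ∑ (λ y → ∑ (λ x → f x y) xs) ys
  ∑-swap f []       ys = sym (∑-zero ys)
  ∑-swap f (x ∷ xs) ys =
    trans (cong (∑ (f x) ys +_) (∑-swap f xs ys)) (sym (∑-+ (f x) (λ y → ∑ (λ x′ → f x′ y) xs) ys))

  𝟙 : Bool → ℕ
  𝟙 true  = 1
  𝟙 false = 0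

  𝟙-∧ : ∀ a b → 𝟙 (a ∧ b) ≡ 𝟙 a * 𝟙 b
  𝟙-∧ true  b = sym (+-identityʳ (𝟙 b))
  𝟙-∧ false b = refl

  𝟙-not+𝟙 : ∀ a → 𝟙 (not a) + 𝟙 a ≡ 1
  𝟙-not+𝟙 true  = refl
  𝟙-not+𝟙 false = refl

  𝟙-∧+𝟙-not-∧ : ∀ a b → 𝟙 (a ∧ b) + 𝟙 (not a ∧ b) ≡ 𝟙 b
  𝟙-∧+𝟙-not-∧ true  b = +-identityʳ (𝟙 b)
  𝟙-∧+𝟙-not-∧ false b = refl

  count : {P : Pred A 0ℓ} → Decidable P → List A → ℕ
  count P? = ∑ (λ x → 𝟙 (does (P? x)))

  module _ {P : Pred A 0ℓ} (P? : Decidable P) where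

    length∘filter≡count : ∀ xs → length (filter P? xs) ≡ count P? xs
    length∘filter≡count []       = refl
    length∘filter≡count (x ∷ xs) with does (P? x)
    ... | true  = cong suc (length∘filter≡count xs)
    ... | false = length∘filter≡count xs

    count-∁+count : ∀ xs → count (∁? P?) xs + count P? xs ≡ length xs
    count-∁+count xs = trans (sym (∑-+ _ _ xs)) (trans (∑-cong (λ x → 𝟙-not+𝟙 (does (P? x))) xs) (∑-one xs))

    count-∁ : ∀ xs → count (∁? P?) xs ≡ length xs ∸ count P? xs
    count-∁ xs = sym (trans (cong (_∸ count P? xs) (sym (count-∁+count xs))) (m+n∸n≡m _ (count P? xs)))

    count-all : (∀ x → P x) → ∀ xs → count P? xs ≡ length xs
    count-all all-P xs = trans (∑-cong (λ x → cong 𝟙 (dec-true (P? x) (all-P x))) xs) (∑-one xs)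

    count-none : (∀ x → ¬ P x) → ∀ xs → count P? xs ≡ 0
    count-none no-P xs = trans (∑-cong (λ x → cong 𝟙 (dec-false (P? x) (no-P x))) xs) (∑-zero xs)

    count≢0⇒any : ∀ xs → count P? xs ≢ 0 → Any P xs
    count≢0⇒any []       ≢0 = contradiction refl ≢0
    count≢0⇒any (x ∷ xs) ≢0 with P? x
    ... | yes px = here px
    ... | no  _  = there (count≢0⇒any xs ≢0)

  count-cong : ∀ {P Q : Pred A 0ℓ} (P? : Decidable P) (Q? : Decidable Q) → (∀ x → P x ⇔ Q x) →
    ∀ xs → count P? xs ≡ count Q? xs
  count-cong P? Q? P⇔Q = ∑-cong (λ x → cong 𝟙 (does-⇔ (P⇔Q x) (P? x) (Q? x)))

  count-filter : ∀ {P Q : Pred A 0ℓ} (P? : Decidable P) (Q? : Decidable Q) xs →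
    count Q? (filter P? xs) ≡ count (P? ∩? Q?) xs
  count-filter P? Q? []       = refl
  count-filter P? Q? (x ∷ xs) with does (P? x)
  ... | true  = cong (𝟙 (does (Q? x)) +_) (count-filter P? Q? xs)
  ... | false = count-filter P? Q? xs

  count-filter+count-filter-∁ : ∀ {P Q : Pred A 0ℓ} (P? : Decidable P) (Q? : Decidable Q) xs →
    count Q? (filter P? xs) + count Q? (filter (∁? P?) xs) ≡ count Q? xs
  count-filter+count-filter-∁ P? Q? xs =
    trans (cong₂ _+_ (count-filter P? Q? xs) (count-filter (∁? P?) Q? xs))
          (trans (sym (∑-+ _ _ xs)) (∑-cong (λ x → 𝟙-∧+𝟙-not-∧ (does (P? x)) (does (Q? x))) xs))

  -- The key (the block of a design) has no decidable equality, so the class of x is described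
  -- by the decidable predicate R x px instead.
  module _ {P : Pred A 0ℓ} {I : Set} (key : ∀ x → P x → I)
           {R : ∀ x → P x → Pred A 0ℓ} (R? : ∀ x px → Decidable (R x px))
           (R⇔key : ∀ x px y py → R x px y ⇔ key x px ≡ key y py) where

    open Equivalence using (to; from)

    private
      R-refl : ∀ x px → R x px x
      R-refl x px = from (R⇔key x px x px) refl

      R-sym : ∀ x px y py → R x px y → R y py x
      R-sym x px y py r = from (R⇔key y py x px) (sym (to (R⇔key x px y py) r))

      R-disjoint : ∀ x px y py → ¬ R x px y → ∀ zs → All P zs → count (R? x px ∩? R? y py) zs ≡ 0
      R-disjoint x px y py ¬xy []       []         = refl
      R-disjoint x px y py ¬xy (z ∷ zs) (pz ∷ pzs) with R? x px z | R? y py z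
      ... | yes xz | yes yz =
        contradiction (from (R⇔key x px y py) (trans (to (R⇔key x px z pz) xz) (sym (to (R⇔key y py z pz) yz)))) ¬xy
      ... | yes _  | no  _  = R-disjoint x px y py ¬xy zs pzs
      ... | no  _  | _      = R-disjoint x px y py ¬xy zs pzs

      count+length-rest : ∀ x px xs → count (R? x px) (x ∷ xs) + length (filter (∁? (R? x px)) xs) ≡ suc (length xs)
      count+length-rest x px xs = begin
        count (R? x px) (x ∷ xs) + length (filter (∁? (R? x px)) xs)
          ≡⟨ cong₂ (λ b n → 𝟙 b + count (R? x px) xs + n) (dec-true (R? x px x) (R-refl x px)) (length∘filter≡count (∁? (R? x px)) xs) ⟩
        suc (count (R? x px) xs + count (∁? (R? x px)) xs)
          ≡⟨ cong suc (+-comm (count (R? x px) xs) _) ⟩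
        suc (count (∁? (R? x px)) xs + count (R? x px) xs)
          ≡⟨ cong suc (count-∁+count (R? x px) xs) ⟩
        suc (length xs) ∎
        where open ≡-Reasoning

      count-rest : ∀ x px y py xs → All P xs → ¬ R x px y →
        count (R? y py) (filter (∁? (R? x px)) xs) ≡ count (R? y py) (x ∷ xs)
      count-rest x px y py xs pxs ¬xy = begin
        count (R? y py) (filter (∁? (R? x px)) xs)
          ≡⟨ cong (_+ count (R? y py) (filter (∁? (R? x px)) xs))
                  (sym (trans (count-filter (R? x px) (R? y py) xs) (R-disjoint x px y py ¬xy xs pxs))) ⟩
        count (R? y py) (filter (R? x px) xs) + count (R? y py) (filter (∁? (R? x px)) xs)
          ≡⟨ count-filter+count-filter-∁ (R? x px) (R? y py) xs ⟩
        count (R? y py) xs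
          ≡⟨ cong (λ b → 𝟙 b + count (R? y py) xs) (sym (dec-false (R? y py x) (¬xy ∘ R-sym y py x px))) ⟩
        count (R? y py) (x ∷ xs) ∎
        where open ≡-Reasoning

    classes-of-size⇒∣length : ∀ {s} xs → All P xs → (∀ {y} → y ∈ xs → ∀ py → count (R? y py) xs ≡ s) → s ∣ length xs
    classes-of-size⇒∣length {s} xs = go (length xs) xs ≤-refl
      where
      go : ∀ n xs → length xs ≤ n → All P xs → (∀ {y} → y ∈ xs → ∀ py → count (R? y py) xs ≡ s) → s ∣ length xs
      go _       []       _         _          _     = _ ∣0
      go (suc n) (x ∷ xs) (s≤s len) (px ∷ pxs) sizes =
        subst (s ∣_) (trans (cong (_+ length rest) (sym (sizes (here refl) px))) (count+length-rest x px xs))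
              (∣m∣n⇒∣m+n ∣-refl (go n rest (≤-trans (length-filter (∁? (R? x px)) xs) len) (filter⁺ (∁? (R? x px)) pxs) sizes-rest))
        where
        rest : List A
        rest = filter (∁? (R? x px)) xs
        sizes-rest : ∀ {y} → y ∈ rest → ∀ py → count (R? y py) rest ≡ s
        sizes-rest y∈rest py with ∈-filter⁻ (∁? (R? x px)) {xs = xs} y∈rest
        ... | y∈xs , ¬xy = trans (count-rest x px _ py xs pxs ¬xy) (sizes (there y∈xs) py)

    classes-of-size⇒∣count : ∀ {s} (P? : Decidable P) xs → (∀ x px → count (P? ∩? R? x px) xs ≡ s) → s ∣ count P? xs
    classes-of-size⇒∣count {s} P? xs class-size =
      subst (s ∣_) (length∘filter≡count P? xs)
        (classes-of-size⇒∣length (filter P? xs) (all-filter P? xs)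
          (λ {y} _ py → trans (count-filter P? (R? y py) xs) (class-size y py)))

  record Enumeration (A : Set) : Set where
    field
      _≟_         : DecidableEquality A
      elements    : List A
      occurs-once : ∀ a → count (_≟ a) elements ≡ 1

    size : ℕ
    size = length elements

    ∈-elements : ∀ a → a ∈ elements
    ∈-elements a = Any.map sym (count≢0⇒any (_≟ a) elements (λ count≡0 → 1+n≢0 (trans (sym (occurs-once a)) count≡0)))

    ∃? : {P : Pred A 0ℓ} → Decidable P → Dec (∃ P)
    ∃? P? = map′ Any.satisfied (λ (a , pa) → lose (∈-elements a) pa) (Any.any? P? elements)

  open Enumeration

  ↔-enumeration : A ↔ B → Enumeration A → Enumeration B
  ↔-enumeration {A} {B} A↔B E = record { _≟_ = _≟B_ ; elements = map to (elements E) ; occurs-once = occurs-once-B }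
    where
    open Inverse A↔B using (to; from; strictlyInverseˡ; strictlyInverseʳ)
    _≟B_ : DecidableEquality B
    b ≟B b′ = map′ (λ eq → trans (sym (strictlyInverseˡ b)) (trans (cong to eq) (strictlyInverseˡ b′))) (cong from)
                   (_≟_ E (from b) (from b′))
    occurs-once-B : ∀ b → count (_≟B b) (map to (elements E)) ≡ 1
    occurs-once-B b = begin
      count (_≟B b) (map to (elements E))
        ≡⟨ ∑-map _ to (elements E) ⟩
      ∑ (λ a → 𝟙 (does (_≟_ E (from (to a)) (from b)))) (elements E)
        ≡⟨ ∑-cong (λ a → cong (λ a′ → 𝟙 (does (_≟_ E a′ (from b)))) (strictlyInverseʳ a)) (elements E) ⟩
      count (λ a → _≟_ E a (from b)) (elements E)
        ≡⟨ occurs-once E (from b) ⟩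
      1 ∎
      where open ≡-Reasoning

  size-↔ : (A↔B : A ↔ B) (E : Enumeration A) → size (↔-enumeration A↔B E) ≡ size E
  size-↔ A↔B E = length-map (Inverse.to A↔B) (elements E)

  ×-enumeration : Enumeration A → Enumeration B → Enumeration (A × B)
  ×-enumeration EA EB =
    record { _≟_ = _≟×_ ; elements = cartesianProduct (elements EA) (elements EB) ; occurs-once = occurs-once-× }
    where
    _≟×_ : DecidableEquality _
    (a , b) ≟× (a′ , b′) = map′ (uncurry (cong₂ _,_)) ,-injective (_≟_ EA a a′ ×-dec _≟_ EB b b′)
    occurs-once-× : ∀ p → count (_≟× p) (cartesianProduct (elements EA) (elements EB)) ≡ 1
    occurs-once-× (a , b) = begin
      count (_≟× (a , b)) (cartesianProduct (elements EA) (elements EB))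
        ≡⟨ ∑-cartesianProduct _ (elements EA) (elements EB) ⟩
      ∑ (λ x → ∑ (λ y → 𝟙 (does (_≟_ EA x a) ∧ does (_≟_ EB y b))) (elements EB)) (elements EA)
        ≡⟨ ∑-cong (λ x → trans (∑-cong (λ y → 𝟙-∧ (does (_≟_ EA x a)) (does (_≟_ EB y b))) (elements EB))
                                (∑-*ˡ (𝟙 (does (_≟_ EA x a))) (λ y → 𝟙 (does (_≟_ EB y b))) (elements EB))) (elements EA) ⟩
      ∑ (λ x → 𝟙 (does (_≟_ EA x a)) * count (λ y → _≟_ EB y b) (elements EB)) (elements EA)
        ≡⟨ ∑-cong (λ x → trans (cong (𝟙 (does (_≟_ EA x a)) *_) (occurs-once EB b)) (*-identityʳ _)) (elements EA) ⟩
      count (λ x → _≟_ EA x a) (elements EA)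
        ≡⟨ occurs-once EA a ⟩
      1 ∎
      where open ≡-Reasoning

  size-× : (EA : Enumeration A) (EB : Enumeration B) → size (×-enumeration EA EB) ≡ size EA * size EB
  size-× EA EB = begin
    length (cartesianProduct (elements EA) (elements EB))       ≡⟨ sym (∑-one (cartesianProduct (elements EA) (elements EB))) ⟩
    ∑ (λ _ → 1) (cartesianProduct (elements EA) (elements EB))  ≡⟨ ∑-cartesianProduct _ (elements EA) (elements EB) ⟩
    ∑ (λ _ → ∑ (λ _ → 1) (elements EB)) (elements EA)           ≡⟨ ∑-cong (λ _ → trans (∑-one (elements EB)) (sym (*-identityʳ _))) (elements EA) ⟩
    ∑ (λ _ → size EB * 1) (elements EA)                          ≡⟨ ∑-*ˡ (size EB) (λ _ → 1) (elements EA) ⟩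
    size EB * ∑ (λ _ → 1) (elements EA)                          ≡⟨ cong (size EB *_) (∑-one (elements EA)) ⟩
    size EB * size EA                                            ≡⟨ *-comm (size EB) (size EA) ⟩
    size EA * size EB                                            ∎
    where open ≡-Reasoning

  Fin-enumeration : ∀ n → Enumeration (Fin n)
  Fin-enumeration n = record { _≟_ = Fin._≟_ ; elements = allFin n ; occurs-once = occurs-once-Fin }
    where
    occurs-once-Fin : ∀ {n} (i : Fin n) → count (Fin._≟ i) (allFin n) ≡ 1
    occurs-once-Fin {suc n} i =
      trans (cong (λ xs → count (Fin._≟ i) (Fin.zero ∷ xs)) (sym (map-tabulate (λ j → j) Fin.suc)))
            (trans (cong (𝟙 (does (Fin.zero Fin.≟ i)) +_) (∑-map _ Fin.suc (allFin n))) (head+tail i))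
      where
      head+tail : ∀ i → 𝟙 (does (Fin.zero Fin.≟ i)) + ∑ (λ j → 𝟙 (does (Fin.suc j Fin.≟ i))) (allFin n) ≡ 1
      head+tail Fin.zero    = cong suc (∑-zero (allFin n))
      head+tail (Fin.suc i) = occurs-once-Fin i

  size-Fin : ∀ n → size (Fin-enumeration n) ≡ n
  size-Fin n = length-tabulate (λ i → i)

  ×↔∷ : ∀ {n} → (A × Vec A n) ↔ Vec A (suc n)
  ×↔∷ = mk↔ₛ′ (uncurry _∷_) (λ xs → Vec.head xs , Vec.tail xs) (λ { (x ∷ xs) → refl }) (λ _ → refl)

  Vec-enumeration : Enumeration A → ∀ n → Enumeration (Vec A n)
  Vec-enumeration E zero    = record { _≟_ = λ { [] [] → yes refl } ; elements = [] ∷ [] ; occurs-once = λ { [] → refl } }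
  Vec-enumeration E (suc n) = ↔-enumeration ×↔∷ (×-enumeration E (Vec-enumeration E n))

  size-Vec : (E : Enumeration A) → ∀ n → size (Vec-enumeration E n) ≡ size E ^ n
  size-Vec E zero    = refl
  size-Vec E (suc n) = trans (size-↔ ×↔∷ (×-enumeration E (Vec-enumeration E n)))
                             (trans (size-× E (Vec-enumeration E n)) (cong (size E *_) (size-Vec E n)))

  -- Double counting of the pairs (a, b) with Q b and φ a ≡ b.
  count-along-injection : (EA : Enumeration A) (EB : Enumeration B) (φ : A → B) → Injective _≡_ _≡_ φ →
    {Q : Pred B 0ℓ} (Q? : Decidable Q) → (∀ {b} → Q b → ∃ λ a → φ a ≡ b) →
    count Q? (elements EB) ≡ count (Q? ∘ φ) (elements EA)
  count-along-injection {A} {B} EA EB φ φ-injective Q? Q⊆image = begin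
    count Q? (elements EB)                                        ≡⟨ ∑-cong count-fibre (elements EB) ⟩
    ∑ (λ b → ∑ (λ a → incidence a b) (elements EA)) (elements EB) ≡⟨ ∑-swap (λ b a → incidence a b) (elements EB) (elements EA) ⟩
    ∑ (λ a → ∑ (incidence a) (elements EB)) (elements EA)         ≡⟨ ∑-cong count-image (elements EA) ⟩
    count (Q? ∘ φ) (elements EA)                                  ∎
    where
    open ≡-Reasoning
    incidence : A → B → ℕ
    incidence a b = 𝟙 (does (Q? b)) * 𝟙 (does (_≟_ EB (φ a) b))

    count-fibre : ∀ b → 𝟙 (does (Q? b)) ≡ ∑ (λ a → incidence a b) (elements EA)
    count-fibre b with Q? b
    ... | no  _  = sym (∑-zero (elements EA))
    ... | yes qb with Q⊆image qb
    ... | a₀ , refl = sym (begin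
      ∑ (λ a → 𝟙 (does (_≟_ EB (φ a) (φ a₀))) + 0) (elements EA)
        ≡⟨ ∑-cong (λ a → trans (+-identityʳ _) (cong 𝟙 (does-⇔ φa≡φa₀⇔a≡a₀ (_≟_ EB (φ a) (φ a₀)) (_≟_ EA a a₀)))) (elements EA) ⟩
      count (λ a → _≟_ EA a a₀) (elements EA)
        ≡⟨ occurs-once EA a₀ ⟩
      1 ∎)
      where
      φa≡φa₀⇔a≡a₀ : ∀ {a} → (φ a ≡ φ a₀) ⇔ (a ≡ a₀)
      φa≡φa₀⇔a≡a₀ = mk⇔ φ-injective (cong φ)

    count-image : ∀ a → ∑ (incidence a) (elements EB) ≡ 𝟙 (does (Q? (φ a)))
    count-image a = begin
      ∑ (incidence a) (elements EB)
        ≡⟨ ∑-cong incidence≡ (elements EB) ⟩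
      ∑ (λ b → 𝟙 (does (Q? (φ a))) * 𝟙 (does (_≟_ EB b (φ a)))) (elements EB)
        ≡⟨ ∑-*ˡ (𝟙 (does (Q? (φ a)))) (λ b → 𝟙 (does (_≟_ EB b (φ a)))) (elements EB) ⟩
      𝟙 (does (Q? (φ a))) * count (λ b → _≟_ EB b (φ a)) (elements EB)
        ≡⟨ cong (𝟙 (does (Q? (φ a))) *_) (occurs-once EB (φ a)) ⟩
      𝟙 (does (Q? (φ a))) * 1
        ≡⟨ *-identityʳ _ ⟩
      𝟙 (does (Q? (φ a))) ∎
      where
      incidence≡ : ∀ b → incidence a b ≡ 𝟙 (does (Q? (φ a))) * 𝟙 (does (_≟_ EB b (φ a)))
      incidence≡ b with _≟_ EB (φ a) b
      ... | yes refl = cong (λ t → 𝟙 (does (Q? b)) * 𝟙 t) (sym (dec-true (_≟_ EB b b) refl))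
      ... | no  φa≢b = trans (*-zeroʳ (𝟙 (does (Q? b))))
                             (sym (trans (cong (λ t → 𝟙 (does (Q? (φ a))) * 𝟙 t) (dec-false (_≟_ EB b (φ a)) (φa≢b ∘ sym)))
                                         (*-zeroʳ (𝟙 (does (Q? (φ a)))))))

module FieldVectors {q : ℕ} (F : FiniteField q) where

  open import Algebra.Bundles using (CommutativeRing)
  open import Data.Fin as Fin using (Fin; zero; suc)
  open import Data.Nat as ℕ using (ℕ; zero; suc; _∸_; _^_)
  import Data.Nat.Properties as ℕₚ
  open import Data.Product using (∃; _×_; _,_; proj₁; proj₂)
  open import Data.Vec as Vec using (Vec; []; _∷_; replicate; zipWith; lookup; tabulate)
  import Data.Vec.Properties as Vec
  open import Function using (_∘_; _⇔_; mk⇔; Equivalence)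
  open import Function.Properties.Inverse using (↔-sym)
  open import Relation.Binary.PropositionalEquality
  open import Relation.Binary.Definitions using (DecidableEquality)
  open import Relation.Nullary using (¬_; Dec; yes; no; contradiction; ¬?; _×-dec_)
  open import Relation.Unary using (Decidable)
  open import Relation.Unary.Properties using (∁?)
  open import Relation.Nullary.Decidable using (does; map′)

  open Counting

  open FiniteField F renaming (Carrier to K; _+_ to infixl 6 _+_; _*_ to infixl 7 _*_; -_ to infix 8 -_)

  ring : CommutativeRing _ _
  ring = record { isCommutativeRing = isCommutativeRing }

  open CommutativeRing ring using (+-identityˡ; +-identityʳ; -‿inverseʳ; *-assoc; *-comm; *-identityˡ; *-identityʳ;
    distribˡ; distribʳ; zeroˡ; zeroʳ; +-commutativeSemigroup)
  open import Algebra.Properties.Ring (CommutativeRing.ring ring)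
    using (-‿distribˡ-*; -‿distribʳ-*; -1*x≈-x; +-inverseʳ-unique; x∙y⁻¹≈ε⇒x≈y)
  open import Algebra.Properties.CommutativeSemigroup +-commutativeSemigroup using (interchange)
  open Enumeration

  scalars : Enumeration K
  scalars = ↔-enumeration (↔-sym enum) (Fin-enumeration q)

  size-scalars : size scalars ≡ q
  size-scalars = trans (size-↔ (↔-sym enum) (Fin-enumeration q)) (size-Fin q)

  infix 4 _≟K_
  _≟K_ : DecidableEquality K
  _≟K_ = _≟_ scalars

  vectors : ∀ n → Enumeration (Vec K n)
  vectors = Vec-enumeration scalars

  size-vectors : ∀ n → size (vectors n) ≡ q ^ n
  size-vectors n = trans (size-Vec scalars n) (cong (_^ n) size-scalars)

  module _ {n : ℕ} where
    open VectorSpace F n public using (lincomb; LinearlyIndependent)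

  -- These agree definitionally with the operations of VectorSpace, in terms of which lincomb is defined.
  infixl 6 _+ᵛ_
  infixr 7 _·_

  0ᵛ : ∀ {n} → Vec K n
  0ᵛ {n} = replicate n 0#

  _+ᵛ_ : ∀ {n} → Vec K n → Vec K n → Vec K n
  _+ᵛ_ = zipWith _+_

  _·_ : ∀ {n} → K → Vec K n → Vec K n
  a · x = Vec.map (a *_) x

  +ᵛ-identityˡ : ∀ {n} (x : Vec K n) → 0ᵛ +ᵛ x ≡ x
  +ᵛ-identityˡ = Vec.zipWith-identityˡ +-identityˡ

  +ᵛ-identityʳ : ∀ {n} (x : Vec K n) → x +ᵛ 0ᵛ ≡ x
  +ᵛ-identityʳ = Vec.zipWith-identityʳ +-identityʳ

  +ᵛ-interchange : ∀ {n} (w x y z : Vec K n) → (w +ᵛ x) +ᵛ (y +ᵛ z) ≡ (w +ᵛ y) +ᵛ (x +ᵛ z)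
  +ᵛ-interchange []       []       []       []       = refl
  +ᵛ-interchange (w ∷ ws) (x ∷ xs) (y ∷ ys) (z ∷ zs) = cong₂ _∷_ (interchange w x y z) (+ᵛ-interchange ws xs ys zs)

  ·-distribˡ : ∀ {n} a (x y : Vec K n) → a · (x +ᵛ y) ≡ a · x +ᵛ a · y
  ·-distribˡ a []       []       = refl
  ·-distribˡ a (x ∷ xs) (y ∷ ys) = cong₂ _∷_ (distribˡ a x y) (·-distribˡ a xs ys)

  ·-distribʳ : ∀ {n} a b (x : Vec K n) → (a + b) · x ≡ a · x +ᵛ b · x
  ·-distribʳ a b []       = refl
  ·-distribʳ a b (x ∷ xs) = cong₂ _∷_ (distribʳ x a b) (·-distribʳ a b xs)

  ·-assoc : ∀ {n} a b (x : Vec K n) → a · b · x ≡ (a * b) · x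
  ·-assoc a b []       = refl
  ·-assoc a b (x ∷ xs) = cong₂ _∷_ (sym (*-assoc a b x)) (·-assoc a b xs)

  ·-identityˡ : ∀ {n} (x : Vec K n) → 1# · x ≡ x
  ·-identityˡ []       = refl
  ·-identityˡ (x ∷ xs) = cong₂ _∷_ (*-identityˡ x) (·-identityˡ xs)

  ·-zeroˡ : ∀ {n} (x : Vec K n) → 0# · x ≡ 0ᵛ
  ·-zeroˡ []       = refl
  ·-zeroˡ (x ∷ xs) = cong₂ _∷_ (zeroˡ x) (·-zeroˡ xs)

  ·-zeroʳ : ∀ {n} a → a · 0ᵛ {n} ≡ 0ᵛ
  ·-zeroʳ {zero}  a = refl
  ·-zeroʳ {suc n} a = cong₂ _∷_ (zeroʳ a) (·-zeroʳ a)

  *-cancelʳ : ∀ {a b c} → c ≢ 0# → a * c ≡ b * c → a ≡ b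
  *-cancelʳ {a} {b} {c} c≢0 ac≡bc = begin
    a             ≡⟨ sym (*-identityʳ a) ⟩
    a * 1#        ≡⟨ cong (a *_) (sym c*c⁻¹≡1) ⟩
    a * (c * c⁻¹) ≡⟨ sym (*-assoc a c c⁻¹) ⟩
    a * c * c⁻¹   ≡⟨ cong (_* c⁻¹) ac≡bc ⟩
    b * c * c⁻¹   ≡⟨ *-assoc b c c⁻¹ ⟩
    b * (c * c⁻¹) ≡⟨ cong (b *_) c*c⁻¹≡1 ⟩
    b * 1#        ≡⟨ *-identityʳ b ⟩
    b             ∎
    where
    open ≡-Reasoning
    c⁻¹ : K
    c⁻¹ = proj₁ (inverse c c≢0)
    c*c⁻¹≡1 : c * c⁻¹ ≡ 1#
    c*c⁻¹≡1 = proj₂ (inverse c c≢0)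

  Multiple : ∀ {n} → Vec K n → Vec K n → Set
  Multiple x y = ∃ λ a → y ≡ a · x

  private
    solve-for-second : ∀ {c₀ c₁ e} x y → c₁ * e ≡ 1# → c₀ * x + c₁ * y ≡ 0# → y ≡ - (e * c₀) * x
    solve-for-second {c₀} {c₁} {e} x y c₁e≡1 relation = begin
      y                ≡⟨ sym (*-identityˡ y) ⟩
      1# * y           ≡⟨ cong (_* y) (trans (sym c₁e≡1) (*-comm c₁ e)) ⟩
      e * c₁ * y       ≡⟨ *-assoc e c₁ y ⟩
      e * (c₁ * y)     ≡⟨ cong (e *_) (+-inverseʳ-unique (c₀ * x) (c₁ * y) relation) ⟩
      e * - (c₀ * x)   ≡⟨ sym (-‿distribʳ-* e (c₀ * x)) ⟩
      - (e * (c₀ * x)) ≡⟨ cong -_ (sym (*-assoc e c₀ x)) ⟩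
      - (e * c₀ * x)   ≡⟨ -‿distribˡ-* (e * c₀) x ⟩
      - (e * c₀) * x   ∎
      where open ≡-Reasoning

    solve-for-secondᵛ : ∀ {n c₀ c₁ e} (x y : Vec K n) → c₁ * e ≡ 1# → c₀ · x +ᵛ c₁ · y ≡ 0ᵛ → y ≡ - (e * c₀) · x
    solve-for-secondᵛ []       []       c₁e≡1 relation = refl
    solve-for-secondᵛ (x ∷ xs) (y ∷ ys) c₁e≡1 relation =
      cong₂ _∷_ (solve-for-second x y c₁e≡1 (Vec.∷-injectiveˡ relation)) (solve-for-secondᵛ xs ys c₁e≡1 (Vec.∷-injectiveʳ relation))

  relation⇒multiple : ∀ {n c₀ c₁} (x y : Vec K n) → c₁ ≢ 0# → c₀ · x +ᵛ c₁ · y ≡ 0ᵛ → Multiple x y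
  relation⇒multiple x y c₁≢0 relation = _ , solve-for-secondᵛ x y (proj₂ (inverse _ c₁≢0)) relation

  ·-cancelʳ : ∀ {n a b} {x : Vec K n} → x ≢ 0ᵛ → a · x ≡ b · x → a ≡ b
  ·-cancelʳ {x = []}     x≢0 ax≡bx = contradiction refl x≢0
  ·-cancelʳ {x = x ∷ xs} x≢0 ax≡bx with x ≟K 0#
  ... | yes refl = ·-cancelʳ (λ xs≡0 → x≢0 (cong (0# ∷_) xs≡0)) (Vec.∷-injectiveʳ ax≡bx)
  ... | no  x≢0# = *-cancelʳ x≢0# (Vec.∷-injectiveˡ ax≡bx)

  ·≡0ᵛ⇒≡0 : ∀ {n a} {x : Vec K n} → x ≢ 0ᵛ → a · x ≡ 0ᵛ → a ≡ 0#
  ·≡0ᵛ⇒≡0 {x = x} x≢0 ax≡0 = ·-cancelʳ x≢0 (trans ax≡0 (sym (·-zeroˡ x)))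

  difference≡0ᵛ⇒≡ : ∀ {n} (x y : Vec K n) → x +ᵛ (- 1#) · y ≡ 0ᵛ → x ≡ y
  difference≡0ᵛ⇒≡ []       []       _ = refl
  difference≡0ᵛ⇒≡ (x ∷ xs) (y ∷ ys) d≡0 =
    cong₂ _∷_ (x∙y⁻¹≈ε⇒x≈y x y (trans (cong (x +_) (sym (-1*x≈-x y))) (Vec.∷-injectiveˡ d≡0)))
              (difference≡0ᵛ⇒≡ xs ys (Vec.∷-injectiveʳ d≡0))

  difference-self : ∀ {n} (x : Vec K n) → x +ᵛ (- 1#) · x ≡ 0ᵛ
  difference-self x = begin
    x +ᵛ (- 1#) · x        ≡⟨ cong (_+ᵛ (- 1#) · x) (sym (·-identityˡ x)) ⟩
    1# · x +ᵛ (- 1#) · x   ≡⟨ sym (·-distribʳ 1# (- 1#) x) ⟩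
    (1# + - 1#) · x        ≡⟨ cong (_· x) (-‿inverseʳ 1#) ⟩
    0# · x                 ≡⟨ ·-zeroˡ x ⟩
    0ᵛ                     ∎
    where open ≡-Reasoning

  lincomb-cong : ∀ {n k} {c d : Fin k → K} (b : Fin k → Vec K n) → (∀ i → c i ≡ d i) → lincomb c b ≡ lincomb d b
  lincomb-cong {k = zero}  b c≗d = refl
  lincomb-cong {k = suc k} b c≗d = cong₂ _+ᵛ_ (cong (_· b zero) (c≗d zero)) (lincomb-cong (b ∘ suc) (c≗d ∘ suc))

  lincomb-+ : ∀ {n k} (c d : Fin k → K) (b : Fin k → Vec K n) → lincomb (λ i → c i + d i) b ≡ lincomb c b +ᵛ lincomb d b
  lincomb-+ {k = zero}  c d b = sym (+ᵛ-identityʳ 0ᵛ)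
  lincomb-+ {k = suc k} c d b =
    trans (cong₂ _+ᵛ_ (·-distribʳ (c zero) (d zero) (b zero)) (lincomb-+ (c ∘ suc) (d ∘ suc) (b ∘ suc)))
          (+ᵛ-interchange _ _ _ _)

  lincomb-· : ∀ {n k} a (c : Fin k → K) (b : Fin k → Vec K n) → lincomb (λ i → a * c i) b ≡ a · lincomb c b
  lincomb-· {k = zero}  a c b = sym (·-zeroʳ a)
  lincomb-· {k = suc k} a c b =
    trans (cong₂ _+ᵛ_ (sym (·-assoc a (c zero) (b zero))) (lincomb-· a (c ∘ suc) (b ∘ suc)))
          (sym (·-distribˡ a _ _))

  lincomb-zero : ∀ {n k} (b : Fin k → Vec K n) → lincomb (λ _ → 0#) b ≡ 0ᵛ
  lincomb-zero {k = zero}  b = refl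
  lincomb-zero {k = suc k} b = trans (cong₂ _+ᵛ_ (·-zeroˡ (b zero)) (lincomb-zero (b ∘ suc))) (+ᵛ-identityʳ 0ᵛ)

  combine : ∀ {n k} → (Fin k → Vec K n) → Vec K k → Vec K n
  combine b u = lincomb (lookup u) b

  combine-+ : ∀ {n k} (b : Fin k → Vec K n) u w → combine b (u +ᵛ w) ≡ combine b u +ᵛ combine b w
  combine-+ b u w = trans (lincomb-cong b (λ i → Vec.lookup-zipWith _+_ i u w)) (lincomb-+ (lookup u) (lookup w) b)

  combine-· : ∀ {n k} (b : Fin k → Vec K n) a u → combine b (a · u) ≡ a · combine b u
  combine-· b a u = trans (lincomb-cong b (λ i → Vec.lookup-map i (a *_) u)) (lincomb-· a (lookup u) b)

  combine-0ᵛ : ∀ {n k} (b : Fin k → Vec K n) → combine b 0ᵛ ≡ 0ᵛ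
  combine-0ᵛ b = trans (lincomb-cong b (λ i → Vec.lookup-replicate i 0#)) (lincomb-zero b)

  lincomb≡combine : ∀ {n k} (c : Fin k → K) (b : Fin k → Vec K n) → lincomb c b ≡ combine b (tabulate c)
  lincomb≡combine c b = lincomb-cong b (λ i → sym (Vec.lookup∘tabulate c i))

  lookup≡0⇒≡0ᵛ : ∀ {k} (d : Vec K k) → (∀ i → lookup d i ≡ 0#) → d ≡ 0ᵛ
  lookup≡0⇒≡0ᵛ []      _    = refl
  lookup≡0⇒≡0ᵛ (x ∷ d) d≗0 = cong₂ _∷_ (d≗0 zero) (lookup≡0⇒≡0ᵛ d (d≗0 ∘ suc))

  combine-injective : ∀ {n k} {b : Fin k → Vec K n} → LinearlyIndependent b → ∀ {u w} → combine b u ≡ combine b w → u ≡ w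
  combine-injective {b = b} independent {u} {w} bu≡bw =
    difference≡0ᵛ⇒≡ u w (lookup≡0⇒≡0ᵛ _ (independent _ combines-to-0ᵛ))
    where
    open ≡-Reasoning
    combines-to-0ᵛ : combine b (u +ᵛ (- 1#) · w) ≡ 0ᵛ
    combines-to-0ᵛ = begin
      combine b (u +ᵛ (- 1#) · w)            ≡⟨ combine-+ b u ((- 1#) · w) ⟩
      combine b u +ᵛ combine b ((- 1#) · w)  ≡⟨ cong₂ _+ᵛ_ bu≡bw (combine-· b (- 1#) w) ⟩
      combine b w +ᵛ (- 1#) · combine b w    ≡⟨ difference-self (combine b w) ⟩
      0ᵛ                                      ∎

  Independent : ∀ {n} → Vec K n → Vec K n → Set
  Independent x y = x ≢ 0ᵛ × ¬ Multiple x y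

  IndependentPair : ∀ {n} → Vec K n × Vec K n → Set
  IndependentPair (x , y) = Independent x y

  infix 4 _≟ᵛ_
  _≟ᵛ_ : ∀ {n} → DecidableEquality (Vec K n)
  _≟ᵛ_ {n} = _≟_ (vectors n)

  multiple? : ∀ {n} (x : Vec K n) → Decidable (Multiple x)
  multiple? x y = ∃? scalars (λ a → y ≟ᵛ a · x)

  independent? : ∀ {n} (x : Vec K n) → Decidable (Independent x)
  independent? x y = ¬? (x ≟ᵛ 0ᵛ) ×-dec ¬? (multiple? x y)

  independentPair? : ∀ {n} → Decidable (IndependentPair {n})
  independentPair? (x , y) = independent? x y

  pair : ∀ {n} → Vec K n → Vec K n → Fin 2 → Vec K n
  pair x y zero       = x
  pair x y (suc zero) = y

  lincomb-pair : ∀ {n} (c : Fin 2 → K) (x y : Vec K n) → lincomb c (pair x y) ≡ c zero · x +ᵛ c (suc zero) · y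
  lincomb-pair c x y = cong (c zero · x +ᵛ_) (+ᵛ-identityʳ (c (suc zero) · y))

  independent⇒linearlyIndependent : ∀ {n} {x y : Vec K n} → Independent x y → LinearlyIndependent (pair x y)
  independent⇒linearlyIndependent {x = x} {y} (x≢0 , ¬multiple) c relation = c≡0
    where
    relation′ : c zero · x +ᵛ c (suc zero) · y ≡ 0ᵛ
    relation′ = trans (sym (lincomb-pair c x y)) relation
    c₁≡0 : c (suc zero) ≡ 0#
    c₁≡0 with c (suc zero) ≟K 0#
    ... | yes c₁≡0 = c₁≡0
    ... | no  c₁≢0 = contradiction (relation⇒multiple x y c₁≢0 relation′) ¬multiple
    c₀≡0 : c zero ≡ 0#
    c₀≡0 = ·≡0ᵛ⇒≡0 x≢0 (begin
      c zero · x                     ≡⟨ sym (+ᵛ-identityʳ (c zero · x)) ⟩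
      c zero · x +ᵛ 0ᵛ               ≡⟨ cong (c zero · x +ᵛ_) (sym (trans (cong (_· y) c₁≡0) (·-zeroˡ y))) ⟩
      c zero · x +ᵛ c (suc zero) · y ≡⟨ relation′ ⟩
      0ᵛ                             ∎)
      where open ≡-Reasoning
    c≡0 : ∀ i → c i ≡ 0#
    c≡0 zero       = c₀≡0
    c≡0 (suc zero) = c₁≡0

  module _ {m n : ℕ} (L : Vec K m → Vec K n) (L-· : ∀ a u → L (a · u) ≡ a · L u)
           (L-injective : ∀ {u w} → L u ≡ L w → u ≡ w) where

    L-0ᵛ : L 0ᵛ ≡ 0ᵛ
    L-0ᵛ = trans (cong L (sym (·-zeroˡ 0ᵛ))) (trans (L-· 0# 0ᵛ) (·-zeroˡ (L 0ᵛ)))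

    independent-image⇔ : ∀ u w → Independent (L u) (L w) ⇔ Independent u w
    independent-image⇔ u w = mk⇔
      (λ (Lu≢0 , ¬multiple) → (λ u≡0 → Lu≢0 (trans (cong L u≡0) L-0ᵛ)) ,
                              (λ (a , w≡au) → ¬multiple (a , trans (cong L w≡au) (L-· a u))))
      (λ (u≢0 , ¬multiple) → (λ Lu≡0 → u≢0 (L-injective (trans Lu≡0 (sym L-0ᵛ)))) ,
                             (λ (a , Lw≡aLu) → ¬multiple (a , L-injective (trans Lw≡aLu (sym (L-· a u))))))

  count-multiples : ∀ {n} {x : Vec K n} → x ≢ 0ᵛ → count (multiple? x) (elements (vectors n)) ≡ q
  count-multiples {n} {x} x≢0 = begin
    count (multiple? x) (elements (vectors n))
      ≡⟨ count-along-injection scalars (vectors n) (_· x) (·-cancelʳ x≢0) (multiple? x) (λ (a , y≡ax) → a , sym y≡ax) ⟩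
    count (multiple? x ∘ (_· x)) (elements scalars)
      ≡⟨ count-all (multiple? x ∘ (_· x)) (λ a → a , refl) (elements scalars) ⟩
    size scalars
      ≡⟨ size-scalars ⟩
    q ∎
    where open ≡-Reasoning

  count-independent : ∀ {n} {x : Vec K n} → x ≢ 0ᵛ → count (independent? x) (elements (vectors n)) ≡ q ^ n ∸ q
  count-independent {n} {x} x≢0 = begin
    count (independent? x) (elements (vectors n))
      ≡⟨ count-cong (independent? x) (∁? (multiple? x)) (λ y → mk⇔ proj₂ (x≢0 ,_)) (elements (vectors n)) ⟩
    count (∁? (multiple? x)) (elements (vectors n))
      ≡⟨ count-∁ (multiple? x) (elements (vectors n)) ⟩
    size (vectors n) ∸ count (multiple? x) (elements (vectors n))
      ≡⟨ cong₂ _∸_ (size-vectors n) (count-multiples x≢0) ⟩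
    q ^ n ∸ q ∎
    where open ≡-Reasoning

  pairs : ∀ n → Enumeration (Vec K n × Vec K n)
  pairs n = ×-enumeration (vectors n) (vectors n)

  count-independentPairs : ∀ n → count independentPair? (elements (pairs n)) ≡ (q ^ n ∸ 1) ℕ.* (q ^ n ∸ q)
  count-independentPairs n = begin
    count independentPair? (elements (pairs n))
      ≡⟨ ∑-cartesianProduct (λ p → 𝟙 (does (independentPair? p))) (elements (vectors n)) (elements (vectors n)) ⟩
    ∑ (λ x → count (independent? x) (elements (vectors n))) (elements (vectors n))
      ≡⟨ ∑-cong second-choices (elements (vectors n)) ⟩
    ∑ (λ x → (q ^ n ∸ q) ℕ.* 𝟙 (does (¬? (x ≟ᵛ 0ᵛ)))) (elements (vectors n))
      ≡⟨ ∑-*ˡ (q ^ n ∸ q) (λ x → 𝟙 (does (¬? (x ≟ᵛ 0ᵛ)))) (elements (vectors n)) ⟩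
    (q ^ n ∸ q) ℕ.* count (∁? (_≟ᵛ 0ᵛ)) (elements (vectors n))
      ≡⟨ cong ((q ^ n ∸ q) ℕ.*_) (count-∁ (_≟ᵛ 0ᵛ) (elements (vectors n))) ⟩
    (q ^ n ∸ q) ℕ.* (size (vectors n) ∸ count (_≟ᵛ 0ᵛ) (elements (vectors n)))
      ≡⟨ cong ((q ^ n ∸ q) ℕ.*_) (cong₂ _∸_ (size-vectors n) (occurs-once (vectors n) 0ᵛ)) ⟩
    (q ^ n ∸ q) ℕ.* (q ^ n ∸ 1)
      ≡⟨ ℕₚ.*-comm (q ^ n ∸ q) (q ^ n ∸ 1) ⟩
    (q ^ n ∸ 1) ℕ.* (q ^ n ∸ q) ∎
    where
    open ≡-Reasoning
    second-choices : ∀ x → count (independent? x) (elements (vectors n)) ≡ (q ^ n ∸ q) ℕ.* 𝟙 (does (¬? (x ≟ᵛ 0ᵛ)))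
    second-choices x = by-cases (x ≟ᵛ 0ᵛ)
      -- not a with-abstraction, which would also abstract x ≟ᵛ 0ᵛ inside independent? x
      where
      by-cases : (x≟0 : Dec (x ≡ 0ᵛ)) → count (independent? x) (elements (vectors n)) ≡ (q ^ n ∸ q) ℕ.* 𝟙 (does (¬? x≟0))
      by-cases (yes x≡0) = trans (count-none (independent? x) (λ y (x≢0 , _) → x≢0 x≡0) (elements (vectors n)))
                                 (sym (ℕₚ.*-zeroʳ (q ^ n ∸ q)))
      by-cases (no  x≢0) = trans (count-independent x≢0) (sym (ℕₚ.*-identityʳ (q ^ n ∸ q)))

  module _ {n : ℕ} where
    open VectorSpace F n using (Subspace; _∈_)

    ∈⇔coordinates : ∀ {m} x (U : Subspace m) → x ∈ U ⇔ ∃ λ u → combine (Subspace.basis U) u ≡ x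
    ∈⇔coordinates x U = mk⇔ (λ (c , x≡) → tabulate c , sym (trans x≡ (lincomb≡combine c (Subspace.basis U))))
                            (λ (u , bu≡x) → lookup u , sym bu≡x)

    infix 4 _∈?_
    _∈?_ : ∀ {m} x (U : Subspace m) → Dec (x ∈ U)
    x ∈? U = map′ (Equivalence.from (∈⇔coordinates x U)) (Equivalence.to (∈⇔coordinates x U))
                  (∃? (vectors _) (λ u → combine (Subspace.basis U) u ≟ᵛ x))

    subspace-closed : ∀ {m} (U : Subspace m) {x y} a b → x ∈ U → y ∈ U → (a · x +ᵛ b · y) ∈ U
    subspace-closed {m} U {x} {y} a b x∈U y∈U with Equivalence.to (∈⇔coordinates x U) x∈U | Equivalence.to (∈⇔coordinates y U) y∈U
    ... | u , refl | w , refl = Equivalence.from (∈⇔coordinates _ U) (a · u +ᵛ b · w , (begin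
      combine B (a · u +ᵛ b · w)              ≡⟨ combine-+ B (a · u) (b · w) ⟩
      combine B (a · u) +ᵛ combine B (b · w)  ≡⟨ cong₂ _+ᵛ_ (combine-· B a u) (combine-· B b w) ⟩
      a · combine B u +ᵛ b · combine B w      ∎))
      where
      open ≡-Reasoning
      B : Fin m → Vec K n
      B = Subspace.basis U

module _ {q : ℕ} (F : FiniteField q) {v k : ℕ} (D : SteinerDesign F v k) where

  open import Data.Fin using (Fin; zero; suc)
  open import Data.Nat using (_∸_; _^_; _*_)
  open import Data.Nat.Divisibility using (_∣_)
  open import Data.Product using (∃; _×_; _,_; proj₁; proj₂)
  open import Data.Vec using (Vec; lookup; []; _∷_)
  open import Function using (_∘_; _⇔_; mk⇔; Equivalence)
  open import Relation.Binary.PropositionalEquality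
  open import Relation.Nullary using (_×-dec_)
  open import Relation.Unary using (Decidable)
  open import Relation.Unary.Properties using (_∩?_)

  open Counting

  open FieldVectors F
  open FiniteField F using (0#; 1#) renaming (Carrier to K)
  open Enumeration
  open SteinerDesign D
  open VectorSpace F v using (Subspace; _∈_; _⊆_)
  open Equivalence using (to; from)

  Pair : Set
  Pair = Vec K v × Vec K v

  span : (p : Pair) → IndependentPair p → Subspace 2
  span (x , y) ip = record { basis = pair x y ; independent = independent⇒linearlyIndependent ip }

  blockOf : (p : Pair) → IndependentPair p → Index
  blockOf p ip = proj₁ (steiner (span p ip))

  InBlock : Index → Pair → Set
  InBlock i (x , y) = x ∈ block i × y ∈ block i

  inBlock? : ∀ i → Decidable (InBlock i)
  inBlock? i (x , y) = (x ∈? block i) ×-dec (y ∈? block i)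

  InBlock⇔blockOf : ∀ i p ip → InBlock i p ⇔ i ≡ blockOf p ip
  InBlock⇔blockOf i (x , y) ip = mk⇔ InBlock⇒≡blockOf (λ { refl → span⊆blockOf x x∈span , span⊆blockOf y y∈span })
    where
    open ≡-Reasoning
    span⊆blockOf : span (x , y) ip ⊆ block (blockOf (x , y) ip)
    span⊆blockOf = proj₁ (proj₂ (steiner (span (x , y) ip)))
    x∈span : x ∈ span (x , y) ip
    x∈span = lookup (1# ∷ 0# ∷ []) , sym (begin
      lincomb (lookup (1# ∷ 0# ∷ [])) (pair x y) ≡⟨ lincomb-pair (lookup (1# ∷ 0# ∷ [])) x y ⟩
      1# · x +ᵛ 0# · y                           ≡⟨ cong₂ _+ᵛ_ (·-identityˡ x) (·-zeroˡ y) ⟩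
      x +ᵛ 0ᵛ                                    ≡⟨ +ᵛ-identityʳ x ⟩
      x                                          ∎)
    y∈span : y ∈ span (x , y) ip
    y∈span = lookup (0# ∷ 1# ∷ []) , sym (begin
      lincomb (lookup (0# ∷ 1# ∷ [])) (pair x y) ≡⟨ lincomb-pair (lookup (0# ∷ 1# ∷ [])) x y ⟩
      0# · x +ᵛ 1# · y                           ≡⟨ cong₂ _+ᵛ_ (·-zeroˡ x) (·-identityˡ y) ⟩
      0ᵛ +ᵛ y                                    ≡⟨ +ᵛ-identityˡ y ⟩
      y                                          ∎)
    InBlock⇒≡blockOf : InBlock i (x , y) → i ≡ blockOf (x , y) ip
    InBlock⇒≡blockOf (x∈ , y∈) = proj₂ (proj₂ (steiner (span (x , y) ip))) i
      (λ z (c , z≡) → subst (_∈ block i) (sym (trans z≡ (lincomb-pair c x y)))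
                              (subspace-closed (block i) (c zero) (c (suc zero)) x∈ y∈))

  module _ (i : Index) where
    private
      B : Fin k → Vec K v
      B = Subspace.basis (block i)
      B-independent : LinearlyIndependent B
      B-independent = Subspace.independent (block i)

      coordinates : ∀ {x} → x ∈ block i → ∃ λ u → combine B u ≡ x
      coordinates {x} = to (∈⇔coordinates x (block i))

      combine∈block : ∀ u → combine B u ∈ block i
      combine∈block u = from (∈⇔coordinates (combine B u) (block i)) (u , refl)

      independent-coordinates⇔ : ∀ u w → Independent (combine B u) (combine B w) ⇔ Independent u w
      independent-coordinates⇔ = independent-image⇔ (combine B) (combine-· B) (combine-injective B-independent)

    count-independentPairs-in-block : count (independentPair? ∩? inBlock? i) (elements (pairs v)) ≡ (q ^ k ∸ 1) * (q ^ k ∸ q)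
    count-independentPairs-in-block = begin
      count (independentPair? ∩? inBlock? i) (elements (pairs v))
        ≡⟨ count-along-injection (pairs k) (pairs v) combine² combine²-injective (independentPair? ∩? inBlock? i) image ⟩
      count ((independentPair? ∩? inBlock? i) ∘ combine²) (elements (pairs k))
        ≡⟨ count-cong ((independentPair? ∩? inBlock? i) ∘ combine²) independentPair?
             (λ (u , w) → mk⇔ (to (independent-coordinates⇔ u w) ∘ proj₁)
                              (λ iuw → from (independent-coordinates⇔ u w) iuw , combine∈block u , combine∈block w))
             (elements (pairs k)) ⟩
      count independentPair? (elements (pairs k))
        ≡⟨ count-independentPairs k ⟩
      (q ^ k ∸ 1) * (q ^ k ∸ q) ∎
      where
      open ≡-Reasoning
      combine² : Vec K k × Vec K k → Pair
      combine² (u , w) = combine B u , combine B w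
      combine²-injective : ∀ {s t} → combine² s ≡ combine² t → s ≡ t
      combine²-injective {u , w} {u′ , w′} eq =
        cong₂ _,_ (combine-injective B-independent (cong proj₁ eq)) (combine-injective B-independent (cong proj₂ eq))
      image : ∀ {p} → (IndependentPair p × InBlock i p) → ∃ λ s → combine² s ≡ p
      image (_ , x∈ , y∈) with coordinates x∈ | coordinates y∈
      ... | u , refl | w , refl = (u , w) , refl

    count-independent-in-block : ∀ {x₀} → x₀ ∈ block i → x₀ ≢ 0ᵛ →
      count (independent? x₀ ∩? (_∈? block i)) (elements (vectors v)) ≡ q ^ k ∸ q
    count-independent-in-block x₀∈ x₀≢0 with coordinates x₀∈
    ... | c₀ , refl = begin
      count (independent? (combine B c₀) ∩? (_∈? block i)) (elements (vectors v))
        ≡⟨ count-along-injection (vectors k) (vectors v) (combine B) (combine-injective B-independent)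
             (independent? (combine B c₀) ∩? (_∈? block i)) (coordinates ∘ proj₂) ⟩
      count ((independent? (combine B c₀) ∩? (_∈? block i)) ∘ combine B) (elements (vectors k))
        ≡⟨ count-cong ((independent? (combine B c₀) ∩? (_∈? block i)) ∘ combine B) (independent? c₀)
             (λ d → mk⇔ (to (independent-coordinates⇔ c₀ d) ∘ proj₁)
                        (λ i₀d → from (independent-coordinates⇔ c₀ d) i₀d , combine∈block d))
             (elements (vectors k)) ⟩
      count (independent? c₀) (elements (vectors k))
        ≡⟨ count-independent (λ c₀≡0 → x₀≢0 (trans (cong (combine B) c₀≡0) (combine-0ᵛ B))) ⟩
      q ^ k ∸ q ∎
      where open ≡-Reasoning

  [q^k∸1][q^k∸q]∣[q^v∸1][q^v∸q] : (q ^ k ∸ 1) * (q ^ k ∸ q) ∣ (q ^ v ∸ 1) * (q ^ v ∸ q)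
  [q^k∸1][q^k∸q]∣[q^v∸1][q^v∸q] = subst (_ ∣_) (count-independentPairs v)
    (classes-of-size⇒∣count blockOf (λ p ip → inBlock? (blockOf p ip)) (λ p ip p′ ip′ → InBlock⇔blockOf (blockOf p ip) p′ ip′)
       independentPair? (elements (pairs v)) (λ p ip → count-independentPairs-in-block (blockOf p ip)))

  q^k∸q∣q^v∸q : ∀ {x₀} → x₀ ≢ 0ᵛ → (q ^ k ∸ q) ∣ (q ^ v ∸ q)
  q^k∸q∣q^v∸q {x₀} x₀≢0 = subst (_ ∣_) (count-independent x₀≢0)
    (classes-of-size⇒∣count blockThrough (λ y iy → _∈? block (blockThrough y iy)) same-block
       (independent? x₀) (elements (vectors v))
       (λ y iy → count-independent-in-block (blockThrough y iy) (x₀∈blockThrough y iy) x₀≢0))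
    where
    blockThrough : ∀ y → Independent x₀ y → Index
    blockThrough y iy = blockOf (x₀ , y) iy
    x₀∈blockThrough : ∀ y iy → x₀ ∈ block (blockThrough y iy)
    x₀∈blockThrough y iy = proj₁ (from (InBlock⇔blockOf _ (x₀ , y) iy) refl)
    same-block : ∀ y iy y′ iy′ → y′ ∈ block (blockThrough y iy) ⇔ blockThrough y iy ≡ blockThrough y′ iy′
    same-block y iy y′ iy′ = mk⇔ (λ y′∈ → to (InBlock⇔blockOf _ (x₀ , y′) iy′) (x₀∈blockThrough y iy , y′∈))
                                 (proj₂ ∘ from (InBlock⇔blockOf _ (x₀ , y′) iy′))

module Arithmetic where

  open import Data.Nat
  open import Data.Nat.Properties
  open import Data.Nat.Divisibility
  open import Data.Nat.GCD
  open import Data.Nat.Coprimality using (Coprime; coprime-divisor)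
  open import Data.Product using (_×_; _,_; proj₁)
  open import Data.Sum using (_⊎_; inj₁; inj₂)
  open import Relation.Binary.Definitions using (tri<; tri≈; tri>)
  open import Relation.Binary.PropositionalEquality
  open import Relation.Nullary using (yes; no; contradiction)

  ∣m∣n⇒∣m∸n : ∀ {d m n} → n ≤ m → d ∣ m → d ∣ n → d ∣ m ∸ n
  ∣m∣n⇒∣m∸n {d} {m} {n} n≤m d∣m d∣n = ∣m+n∣m⇒∣n (subst (d ∣_) (sym (m+[n∸m]≡n n≤m)) d∣m) d∣n

  coprime-∣⇒*∣ : ∀ {m n x} → Coprime m n → m ∣ x → n ∣ x → m * n ∣ x
  coprime-∣⇒*∣ {m} {n} cop m∣x (divides t refl) = *-monoˡ-∣ n (coprime-divisor cop (subst (m ∣_) (*-comm t n) m∣x))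

  coprime-suc : ∀ n → Coprime (suc n) n
  coprime-suc n {c} (c∣1+n , c∣n) = ∣1⇒≡1 (∣m+n∣m⇒∣n (subst (c ∣_) (+-comm 1 n) c∣1+n) c∣n)

  ∣*⇒∣gcd*gcd : ∀ d x y → d ∣ x * y → d ∣ gcd d x * gcd d y
  ∣*⇒∣gcd*gcd d x y d∣xy = subst (d ∣_) (sym (c*gcd[m,n]≡gcd[cm,cn] (gcd d x) d y))
                             (gcd-greatest (∣n⇒∣m*n (gcd d x) ∣-refl) d∣gcd[d,x]*y)
    where
    d∣gcd[d,x]*y : d ∣ gcd d x * y
    d∣gcd[d,x]*y = subst (d ∣_) (trans (sym (c*gcd[m,n]≡gcd[cm,cn] y d x)) (*-comm y (gcd d x)))
                         (gcd-greatest (∣n⇒∣m*n y ∣-refl) (subst (d ∣_) (*-comm x y) d∣xy))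

  m+n≤m*n : ∀ {m n} → 2 ≤ m → 2 ≤ n → m + n ≤ m * n
  m+n≤m*n {suc (suc a)} {suc (suc b)} (s≤s (s≤s _)) (s≤s (s≤s _)) = begin
    suc (suc a) + suc (suc b)             ≡⟨ +-comm (suc (suc a)) (suc (suc b)) ⟩
    suc (suc b) + suc (suc a)             ≤⟨ +-monoʳ-≤ (suc (suc b)) (s≤s (s≤s (≤-trans (m≤m*n a (suc (suc b))) (m≤n+m _ b)))) ⟩
    suc (suc a) * suc (suc b)             ∎
    where open ≤-Reasoning

  m<k∧n<k∧m*n≤k⇒m+n≤k : ∀ {m n k} → 1 ≤ m → 1 ≤ n → m < k → n < k → m * n ≤ k → m + n ≤ k
  m<k∧n<k∧m*n≤k⇒m+n≤k {suc zero}    {n}           {k} _ _ _   n<k _    = n<k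
  m<k∧n<k∧m*n≤k⇒m+n≤k {suc (suc a)} {suc zero}    {k} _ _ m<k _   _    = subst (_≤ k) (+-comm 1 (suc (suc a))) m<k
  m<k∧n<k∧m*n≤k⇒m+n≤k {suc (suc a)} {suc (suc b)} {k} _ _ _   _   mn≤k = ≤-trans (m+n≤m*n (s≤s (s≤s z≤n)) (s≤s (s≤s z≤n))) mn≤k

  m*o∣n*p∧o∣p⇒m∣n*p : ∀ {m n o p} .{{_ : NonZero o}} → o ∣ p → m * o ∣ n * p → m ∣ n * p
  m*o∣n*p∧o∣p⇒m∣n*p {m} {n} {o} (divides r refl) mo∣nro =
    ∣-trans (*-cancelʳ-∣ {m} {n * r} o (subst (m * o ∣_) (sym (*-assoc n r o)) mo∣nro)) (*-monoʳ-∣ n (m∣m*n o))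

  -- With k = K + 1 and v = W + 1.
  k*K∣v-1⊎v-k : ∀ {K W} → K ∣ W → suc K ∣ suc W ⊎ suc K ∣ W → suc K * K ∣ W ⊎ (K ≤ W × suc K * K ∣ W ∸ K)
  k*K∣v-1⊎v-k {K} {W} K∣W (inj₂ k∣W) = inj₁ (coprime-∣⇒*∣ (coprime-suc K) k∣W K∣W)
  k*K∣v-1⊎v-k {K} {W} K∣W (inj₁ k∣v) =
    inj₂ (K≤W , coprime-∣⇒*∣ (coprime-suc K) (∣m∣n⇒∣m∸n (s≤s K≤W) k∣v ∣-refl) (∣m∣n⇒∣m∸n K≤W K∣W ∣-refl))
    where
    K≤W : K ≤ W
    K≤W = ≤-pred (∣⇒≤ k∣v)

  module PowerMinusOne (q : ℕ) (1<q : 1 < q) where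

    instance
      q≢0 : NonZero q
      q≢0 = >-nonZero (<-trans z<s 1<q)

    M : ℕ → ℕ
    M a = q ^ a ∸ 1

    suc-M : ∀ a → suc (M a) ≡ q ^ a
    suc-M a = trans (+-comm 1 (M a)) (m∸n+n≡m (m^n>0 q a))

    M-+ : ∀ a b → M (a + b) ≡ q ^ b * M a + M b
    M-+ a b = suc-injective (begin
      suc (M (a + b))          ≡⟨ suc-M (a + b) ⟩
      q ^ (a + b)              ≡⟨ ^-distribˡ-+-* q a b ⟩
      q ^ a * q ^ b            ≡⟨ *-comm (q ^ a) (q ^ b) ⟩
      q ^ b * q ^ a            ≡⟨ cong (q ^ b *_) (sym (suc-M a)) ⟩
      q ^ b * suc (M a)        ≡⟨ *-suc (q ^ b) (M a) ⟩
      q ^ b + q ^ b * M a      ≡⟨ +-comm (q ^ b) (q ^ b * M a) ⟩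
      q ^ b * M a + q ^ b      ≡⟨ cong (q ^ b * M a +_) (sym (suc-M b)) ⟩
      q ^ b * M a + suc (M b)  ≡⟨ +-suc (q ^ b * M a) (M b) ⟩
      suc (q ^ b * M a + M b)  ∎)
      where open ≡-Reasoning

    M∣M[t*a] : ∀ t a → M a ∣ M (t * a)
    M∣M[t*a] zero    a = _ ∣0
    M∣M[t*a] (suc t) a = subst (M a ∣_) (sym (trans (cong M (+-comm a (t * a))) (M-+ (t * a) a)))
                                   (∣m∣n⇒∣m+n (∣n⇒∣m*n (q ^ a) (M∣M[t*a] t a)) ∣-refl)

    M-∣ : ∀ {a b} → a ∣ b → M a ∣ M b
    M-∣ {a} (divides t refl) = M∣M[t*a] t a

    ∣M[x+y]∣M[x]⇒∣M[y] : ∀ {d} x y → d ∣ M (y + x) → d ∣ M x → d ∣ M y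
    ∣M[x+y]∣M[x]⇒∣M[y] {d} x y d∣M[y+x] d∣Mx =
      ∣m+n∣m⇒∣n (subst (d ∣_) (trans (cong M (+-comm y x)) (M-+ x y)) d∣M[y+x]) (∣n⇒∣m*n (q ^ y) d∣Mx)

    ∣M∣M⇒∣M[gcd] : ∀ {d} a b → d ∣ M a → d ∣ M b → d ∣ M (gcd a b)
    ∣M∣M⇒∣M[gcd] {d} a b d∣Ma d∣Mb with Bézout.identity (gcd-GCD a b)
    ... | Bézout.+- x y eq = ∣M[x+y]∣M[x]⇒∣M[y] (y * b) (gcd a b)
                               (subst (λ z → d ∣ M z) (sym eq) (∣-trans d∣Ma (M∣M[t*a] x a))) (∣-trans d∣Mb (M∣M[t*a] y b))
    ... | Bézout.-+ x y eq = ∣M[x+y]∣M[x]⇒∣M[y] (x * a) (gcd a b)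
                               (subst (λ z → d ∣ M z) (sym eq) (∣-trans d∣Mb (M∣M[t*a] y b))) (∣-trans d∣Ma (M∣M[t*a] x a))

    M-gcd : ∀ a b → GCD (M a) (M b) (M (gcd a b))
    M-gcd a b = GCD.is (M-∣ (gcd[m,n]∣m a b) , M-∣ (gcd[m,n]∣n a b)) (λ (d∣Ma , d∣Mb) → ∣M∣M⇒∣M[gcd] a b d∣Ma d∣Mb)

    gcd[M,M]≡M[gcd] : ∀ a b → gcd (M a) (M b) ≡ M (gcd a b)
    gcd[M,M]≡M[gcd] a b = GCD.unique (gcd-GCD (M a) (M b)) (M-gcd a b)

    M-monoˡ-< : ∀ {a b} → a < b → M a < M b
    M-monoˡ-< {a} {b} a<b = ≤-pred (subst₂ _<_ (sym (suc-M a)) (sym (suc-M b)) (^-monoʳ-< q 1<q a<b))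

    M-mono-≤ : ∀ {a b} → a ≤ b → M a ≤ M b
    M-mono-≤ a≤b = ∸-monoˡ-≤ 1 (^-monoʳ-≤ q a≤b)

    M-injective : ∀ {a b} → M a ≡ M b → a ≡ b
    M-injective {a} {b} Ma≡Mb with <-cmp a b
    ... | tri< a<b _ _ = contradiction Ma≡Mb (<⇒≢ (M-monoˡ-< a<b))
    ... | tri≈ _ a≡b _ = a≡b
    ... | tri> _ _ b<a = contradiction (sym Ma≡Mb) (<⇒≢ (M-monoˡ-< b<a))

    M-positive : ∀ {a} → 1 ≤ a → 1 ≤ M a
    M-positive 1≤a = ≤-trans (M-monoˡ-< {0} {1} z<s) (M-mono-≤ 1≤a)

    M∣M⇒∣ : ∀ {a b} → M a ∣ M b → a ∣ b
    M∣M⇒∣ {a} {b} Ma∣Mb = subst (_∣ b) gcd[a,b]≡a (gcd[m,n]∣n a b)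
      where
      gcd[a,b]≡a : gcd a b ≡ a
      gcd[a,b]≡a = M-injective (GCD.unique (M-gcd a b) (GCD.is (∣-refl , Ma∣Mb) proj₁))

    M*M<M[+] : ∀ {a} b → 1 ≤ a → M a * M b < M (a + b)
    M*M<M[+] {a} b 1≤a = begin-strict
      M a * M b          <⟨ *-monoʳ-< (M a) {{>-nonZero (M-positive 1≤a)}} (subst (M b <_) (suc-M b) ≤-refl) ⟩
      M a * q ^ b        ≡⟨ *-comm (M a) (q ^ b) ⟩
      q ^ b * M a        ≤⟨ m≤m+n (q ^ b * M a) (M b) ⟩
      q ^ b * M a + M b  ≡⟨ sym (M-+ a b) ⟩
      M (a + b)          ∎
      where open ≤-Reasoning

    M∣M*M⇒∣⊎∣ : ∀ {k w} → 2 ≤ k → M k ∣ M (suc w) * M w → k ∣ suc w ⊎ k ∣ w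
    M∣M*M⇒∣⊎∣ {k} {w} 2≤k Mk∣ with gcd k (suc w) ≟ k | gcd k w ≟ k
    ... | yes a≡k | _       = inj₁ (subst (_∣ suc w) a≡k (gcd[m,n]∣n k (suc w)))
    ... | no _    | yes b≡k = inj₂ (subst (_∣ w) b≡k (gcd[m,n]∣n k w))
    ... | no a≢k  | no b≢k  = contradiction (∣⇒≤ {{MaMb≢0}} Mk∣MaMb) (<⇒≱ MaMb<Mk)
      where
      instance
        k≢0 : NonZero k
        k≢0 = >-nonZero (<-trans z<s 2≤k)
      a b : ℕ
      a = gcd k (suc w)
      b = gcd k w
      a∣k : a ∣ k
      a∣k = gcd[m,n]∣m k (suc w)
      b∣k : b ∣ k
      b∣k = gcd[m,n]∣m k w
      positive : ∀ {x} → x ∣ k → 1 ≤ x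
      positive x∣k = n≢0⇒n>0 (λ { refl → ≢-nonZero⁻¹ k (0∣⇒≡0 x∣k) })
      a⊥b : Coprime a b
      a⊥b {c} (c∣a , c∣b) = ∣1⇒≡1 (∣m+n∣m⇒∣n (subst (c ∣_) (+-comm 1 w) (∣-trans c∣a (gcd[m,n]∣n k (suc w))))
                                            (∣-trans c∣b (gcd[m,n]∣n k w)))
      a+b≤k : a + b ≤ k
      a+b≤k = m<k∧n<k∧m*n≤k⇒m+n≤k (positive a∣k) (positive b∣k) (≤∧≢⇒< (∣⇒≤ a∣k) a≢k) (≤∧≢⇒< (∣⇒≤ b∣k) b≢k)
                                   (∣⇒≤ (coprime-∣⇒*∣ a⊥b a∣k b∣k))
      MaMb<Mk : M a * M b < M k
      MaMb<Mk = <-≤-trans (M*M<M[+] b (positive a∣k)) (M-mono-≤ a+b≤k)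
      Mk∣MaMb : M k ∣ M a * M b
      Mk∣MaMb = subst₂ (λ x y → M k ∣ x * y) (gcd[M,M]≡M[gcd] k (suc w)) (gcd[M,M]≡M[gcd] k w)
                       (∣*⇒∣gcd*gcd (M k) (M (suc w)) (M w) Mk∣)
      MaMb≢0 : NonZero (M a * M b)
      MaMb≢0 = >-nonZero (*-mono-≤ (M-positive (positive a∣k)) (M-positive (positive b∣k)))

    q^[1+a]∸q≡q*M[a] : ∀ a → q ^ suc a ∸ q ≡ q * M a
    q^[1+a]∸q≡q*M[a] a = trans (cong (q * q ^ a ∸_) (sym (*-identityʳ q))) (sym (*-distribˡ-∸ q (q ^ a) 1))

    q^k∸q∣q^v∸q⇒M[K]∣M[W] : ∀ K W → q ^ suc K ∸ q ∣ q ^ suc W ∸ q → M K ∣ M W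
    q^k∸q∣q^v∸q⇒M[K]∣M[W] K W q^k∸q∣q^v∸q = *-cancelˡ-∣ q (subst₂ _∣_ (q^[1+a]∸q≡q*M[a] K) (q^[1+a]∸q≡q*M[a] W) q^k∸q∣q^v∸q)

    M[k][q^k∸q]∣M[v][q^v∸q]⇒M[k]∣M[v]M[W] : ∀ K W → 1 ≤ K → M K ∣ M W →
      M (suc K) * (q ^ suc K ∸ q) ∣ M (suc W) * (q ^ suc W ∸ q) → M (suc K) ∣ M (suc W) * M W
    M[k][q^k∸q]∣M[v][q^v∸q]⇒M[k]∣M[v]M[W] K W 1≤K MK∣MW divides-pairs =
      m*o∣n*p∧o∣p⇒m∣n*p {n = M (suc W)} {{>-nonZero (M-positive 1≤K)}} MK∣MW
        (*-cancelˡ-∣ q (subst₂ _∣_ (q*M≡ K) (q*M≡ W) divides-pairs))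
      where
      open import Algebra.Properties.CommutativeSemigroup *-commutativeSemigroup using (x∙yz≈y∙xz)
      q*M≡ : ∀ a → M (suc a) * (q ^ suc a ∸ q) ≡ q * (M (suc a) * M a)
      q*M≡ a = trans (cong (M (suc a) *_) (q^[1+a]∸q≡q*M[a] a)) (x∙yz≈y∙xz (M (suc a)) q (M a))

open import Data.Fin as Fin using (Fin)
open import Data.Integer using (+_; _-_; ∣_∣)
import Data.Integer.Properties as ℤ
open import Data.Integer.Divisibility using (_∣_)
open import Data.Nat using (zero; suc; _≤_; _<_; _*_; _∸_; s≤s; z≤n)
import Data.Nat.Divisibility as ℕ
open import Data.Sum as Sum using (_⊎_)
open import Data.Product using (_,_)
open import Data.Vec using (_∷_)
import Data.Vec.Properties as Vec
open import Function.Bundles using (Inverse)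
open import Relation.Binary.PropositionalEquality
open import Relation.Nullary using (contradiction)
open Arithmetic

finiteField-1<q : ∀ {q} → FiniteField q → 1 < q
finiteField-1<q {zero} F with Inverse.to (FiniteField.enum F) (FiniteField.0# F)
... | ()
finiteField-1<q {suc zero} F = contradiction 0#≡1# 0≢1
  where
  open FiniteField F
  open Inverse enum
  Fin1-unique : (i j : Fin 1) → i ≡ j
  Fin1-unique Fin.zero Fin.zero = refl
  0#≡1# : 0# ≡ 1#
  0#≡1# = trans (sym (strictlyInverseʳ 0#)) (trans (cong from (Fin1-unique (to 0#) (to 1#))) (strictlyInverseʳ 1#))
finiteField-1<q {suc (suc _)} F = s≤s (s≤s z≤n)

∣m∸n⇒∣+m-+n : ∀ {d m n} → n ≤ m → d ℕ.∣ m ∸ n → + d ∣ + m - + n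
∣m∸n⇒∣+m-+n {d} {m} {n} n≤m = subst (d ℕ.∣_) (sym (cong ∣_∣ (trans (ℤ.m-n≡m⊖n m n) (ℤ.⊖-≥ n≤m))))

theorem6p1 : ∀ (q v k : ℕ) → IsPrimePower q → 2 ≤ k → 1 ≤ v →
    (F : FiniteField q) → SteinerDesign F v k →
    (+ (k * (k ∸ 1)) ∣ (+ v - + 1)) ⊎ (+ (k * (k ∸ 1)) ∣ (+ v - + k))
theorem6p1 q (suc W) (suc K) _ (s≤s 1≤K) _ F D =
  Sum.map (∣m∸n⇒∣+m-+n (s≤s z≤n)) (λ (K≤W , k*K∣v∸k) → ∣m∸n⇒∣+m-+n (s≤s K≤W) k*K∣v∸k)
          (k*K∣v-1⊎v-k (M∣M⇒∣ MK∣MW) (M∣M*M⇒∣⊎∣ (s≤s 1≤K) Mk∣Mv*MW))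
  where
  open FiniteField F using (0#; 1#; 0≢1)
  open FieldVectors F using (0ᵛ)
  open PowerMinusOne q (finiteField-1<q F)
  x₀≢0ᵛ : 1# ∷ 0ᵛ ≢ 0ᵛ
  x₀≢0ᵛ x₀≡0ᵛ = 0≢1 (sym (Vec.∷-injectiveˡ x₀≡0ᵛ))
  MK∣MW : M K ℕ.∣ M W
  MK∣MW = q^k∸q∣q^v∸q⇒M[K]∣M[W] K W (q^k∸q∣q^v∸q F D x₀≢0ᵛ)
  Mk∣Mv*MW : M (suc K) ℕ.∣ M (suc W) * M W
  Mk∣Mv*MW = M[k][q^k∸q]∣M[v][q^v∸q]⇒M[k]∣M[v]M[W] K W 1≤K MK∣MW ([q^k∸1][q^k∸q]∣[q^v∸1][q^v∸q] F D)
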